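{- Let $\Pi$ be a projective plane, $k \geq 4$, and $QG_k = (P_1, \dots, P_k)$ a quasi $k$-gon with $|\mathcal{L}_{QG_k}| = k-1$. Suppose there exists $m$ such that $P_mP_{m+1} = P_{m+1}P_{m+2}$ (indices modulo $k$). Then $|S(QG_k)| = 2k$.
   Context: Let $\Pi$ be a projective plane; for distinct points $A, B$, $AB$ denotes the line through them. For $k \geq 3$, a quasi $k$-gon is a sequence $QG_k = (P_1, \dots, P_k)$ of $k$ distinct points of $\Pi$, with indices read modulo $k$. Let $\mathcal{L}_{QG_k}$ be the set of distinct lines among $P_1P_2, \dots, P_kP_1$. The graph $\Gamma_{QG_k}$ has vertex set $\{P_1, \dots, P_k\} \cup \mathcal{L}_{QG_k}$, and its edges join each $P_i$ to the lines $P_{i-1}P_i$ and $P_iP_{i+1}$ (a single edge if these coincide), and no other edges. $S_k$ acts by $\tau(QG_k) = (P_{\tau(1)}, \dots, P_{\tau(k)})$, and $S(QG_k) = \{\tau \in S_k : \Gamma_{\tau(QG_k)} = \Gamma_{QG_k}\}$ (same vertex and edge sets). -}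

module Defs where

open import Level using (0ℓ)
open import Data.Nat using (ℕ; zero; suc; _∸_; _%_)
open import Data.Nat.DivMod using (m%n<n)
open import Data.Fin using (Fin; toℕ; fromℕ<)
open import Data.Product using (Σ; ∃; _×_; _,_)
open import Data.Sum using (_⊎_)
open import Relation.Binary.PropositionalEquality using (_≡_; _≢_)
open import Relation.Nullary using (¬_)
open import Function.Base using (_∘_)
open import Function.Bundles using (_⇔_)
open import Function.Definitions using (Injective; Bijective)

record ProjectivePlane : Set₁ where
  field
    Point : Set
    Line  : Set
    _I_   : Point → Line → Set
    line-exists : ∀ (A B : Point) → A ≢ B → Σ Line (λ L → (A I L) × (B I L))
    line-unique : ∀ {A B : Point} {L M : Line} → A ≢ B →
                  A I L → B I L → A I M → B I M → L ≡ M
    point-exists : ∀ (L M : Line) → L ≢ M → Σ Point (λ A → (A I L) × (A I M))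
    point-unique : ∀ {L M : Line} {A B : Point} → L ≢ M →
                   A I L → A I M → B I L → B I M → A ≡ B
    quadrangle : Σ Point λ A → Σ Point λ B → Σ Point λ C → Σ Point λ D →
                   (A ≢ B) × (A ≢ C) × (A ≢ D) × (B ≢ C) × (B ≢ D) × (C ≢ D) ×
                   (∀ L → ¬ ((A I L) × (B I L) × (C I L))) ×
                   (∀ L → ¬ ((A I L) × (B I L) × (D I L))) ×
                   (∀ L → ¬ ((A I L) × (C I L) × (D I L))) ×
                   (∀ L → ¬ ((B I L) × (C I L) × (D I L)))

-- successor of an index modulo k  (indices 0..k-1 stand for 1..k)
next : ∀ {k} → Fin k → Fin k
next {suc n} i = fromℕ< (m%n<n (suc (toℕ i)) (suc n))

module _ (Π : ProjectivePlane) where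
  open ProjectivePlane Π

  QuasiGon : ℕ → Set
  QuasiGon k = Fin k → Point

  IsQuasiGon : ∀ {k} → QuasiGon k → Set
  IsQuasiGon P = Injective _≡_ _≡_ P

  IsSide : ∀ {k} → QuasiGon k → Fin k → Line → Set
  IsSide P i L = (P i I L) × (P (next i) I L)

  VertP : ∀ {k} → QuasiGon k → Point → Set
  VertP P Q = ∃ λ i → Q ≡ P i

  InL : ∀ {k} → QuasiGon k → Line → Set
  InL P L = ∃ λ i → IsSide P i L

  -- edges of Γ: P_i is joined to P_{i-1}P_i and P_iP_{i+1},
  -- i.e. each side P_iP_{i+1} is joined to P_i and P_{i+1}
  Edge : ∀ {k} → QuasiGon k → Point → Line → Set
  Edge P Q L = ∃ λ i → IsSide P i L × ((Q ≡ P i) ⊎ (Q ≡ P (next i)))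

  SameGraph : ∀ {k} → QuasiGon k → QuasiGon k → Set
  SameGraph P P' = (∀ Q → VertP P Q ⇔ VertP P' Q)
                 × (∀ L → InL P L ⇔ InL P' L)
                 × (∀ Q L → Edge P Q L ⇔ Edge P' Q L)

  LinesCard : ∀ {k} → QuasiGon k → ℕ → Set
  LinesCard P c = Σ (Fin c → Line) λ f →
                    Injective _≡_ _≡_ f × (∀ j → InL P (f j)) ×
                    (∀ L → InL P L → ∃ λ j → f j ≡ L)

  InS : ∀ {k} → QuasiGon k → (Fin k → Fin k) → Set
  InS P τ = Bijective _≡_ _≡_ τ × SameGraph (P ∘ τ) P

_≗ₚ_ : ∀ {k} → (Fin k → Fin k) → (Fin k → Fin k) → Set
σ ≗ₚ τ = ∀ i → σ i ≡ τ i

module _ (Π : ProjectivePlane) where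
  SCard : ∀ {k} → QuasiGon Π k → ℕ → Set
  SCard {k} P c = Σ (Fin c → (Fin k → Fin k)) λ f →
                    (∀ j → InS Π P (f j)) ×
                    (∀ j j' → f j ≗ₚ f j' → j ≡ j') ×
                    (∀ τ → InS Π P τ → ∃ λ j → f j ≗ₚ τ)

-- The graph Γ only records which vertices are joined by a side and which sides
-- share a line.  The k sides span k − 1 lines and the sides m, m + 1 share the
-- line L, so by counting no other two sides share a line.  A symmetry τ therefore
-- sends consecutive vertices to two vertices on a common side line: consecutive
-- vertices, or two of the three points P_m, P_{m+1}, P_{m+2} of L.  The pair
-- {P_m, P_{m+2}} is impossible: the two neighbours of τ⁻¹(m + 1) are already sent
-- to those points, and for k ≥ 4 they are not consecutive.  So τ preserves
-- adjacency in ℤ/k and is a rotation or a reflection; conversely, the 2k rotations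
-- and reflections preserve Γ, and they are pairwise distinct since k ≥ 3.

module Submission where

open import Defs
open import Data.Nat using (ℕ; zero; suc; _≤_; _<_; _∸_; _*_; _%_; z<s)
open import Data.Nat.Properties using (+-comm; <-trans; <-irrefl; <⇒≤; 1+n≰n; n<1+n; m≤n⇒m<n∨m≡n)
open import Data.Nat.DivMod using (m%n<n; m<n⇒m%n≡m; n%n≡0)
open import Data.Fin using (Fin; zero; suc; toℕ; punchOut)
open import Data.Fin.Properties
  using (toℕ-fromℕ<; toℕ-injective; toℕ<n; _≟_; any?; punchOut-injective; injective⇒≤; *↔×)
open import Data.Product using (Σ; ∃; ∃₂; _×_; _,_; proj₁; proj₂)
open import Data.Sum using (_⊎_; inj₁; inj₂; swap)
open import Data.Empty using (⊥; ⊥-elim)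
open import Function.Base using (_∘_)
open import Function.Bundles using (Bijection; Equivalence; Inverse; _↔_; mk↔ₛ′; mk⇔)
open import Function.Definitions using (Injective; Bijective; StrictlySurjective)
open import Function.Consequences.Propositional using (surjective⇒strictlySurjective)
open import Function.Properties.Inverse using (↔⇒⤖)
open import Relation.Binary.PropositionalEquality
open import Relation.Nullary using (yes; no; contradiction)

_≐_ : {A : Set} → A × A → A × A → Set
(a , b) ≐ (c , d) = (a ≡ c × b ≡ d) ⊎ (a ≡ d × b ≡ c)

≐-sym : ∀ {A : Set} {p q : A × A} → p ≐ q → q ≐ p
≐-sym (inj₁ (refl , refl)) = inj₁ (refl , refl)
≐-sym (inj₂ (refl , refl)) = inj₂ (refl , refl)

≐-map : ∀ {A B : Set} (f : A → B) {a b c d} → (a , b) ≐ (c , d) → (f a , f b) ≐ (f c , f d)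
≐-map f (inj₁ (e , e′)) = inj₁ (cong f e , cong f e′)
≐-map f (inj₂ (e , e′)) = inj₂ (cong f e , cong f e′)

missed-unique : ∀ {n} {s : Fin n → Fin (suc n)} {u v} → Injective _≡_ _≡_ s →
                (∀ a → s a ≢ u) → (∀ a → s a ≢ v) → u ≡ v
missed-unique {zero} {u = zero} {v = zero} _ _ _ = refl
missed-unique {suc n} {s} {u} {v} s-inj u∉s v∉s with u ≟ v
... | yes u≡v = u≡v
... | no u≢v = contradiction (injective⇒≤ squeeze-injective) 1+n≰n
  where
  u≢s : ∀ a → u ≢ s a
  u≢s a = u∉s a ∘ sym
  v′≢s′ : ∀ a → punchOut u≢v ≢ punchOut (u≢s a)
  v′≢s′ a e = v∉s a (sym (punchOut-injective u≢v (u≢s a) e))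
  squeeze : Fin (suc n) → Fin n
  squeeze a = punchOut (v′≢s′ a)
  squeeze-injective : Injective _≡_ _≡_ squeeze
  squeeze-injective e = s-inj (punchOut-injective (u≢s _) (u≢s _) (punchOut-injective (v′≢s′ _) (v′≢s′ _) e))

module _ {A : Set} {n} {g : Fin (suc n) → A} {s : Fin n → Fin (suc n)}
         (g∘s-injective : Injective _≡_ _≡_ (g ∘ s)) where

  Missed : Fin (suc n) → Set
  Missed u = ∀ a → s a ≢ u

  s-injective : Injective _≡_ _≡_ s
  s-injective = g∘s-injective ∘ cong g

  collision-missed : ∀ {x y} → g x ≡ g y → x ≢ y → Missed x ⊎ Missed y
  collision-missed {x} {y} gx≡gy x≢y with any? (λ a → s a ≟ x)
  ... | no x∉s = inj₁ (λ a e → x∉s (a , e))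
  ... | yes (a , refl) = inj₂ (λ b e → x≢y (trans (cong s (g∘s-injective (trans gx≡gy (cong g (sym e))))) e))

  collision-partner : ∀ {x y w} → Missed x → g x ≡ g y → x ≢ y → g x ≡ g w → x ≢ w → w ≡ y
  collision-partner {x} {y} {w} x-missed gx≡gy x≢y gx≡gw x≢w with w ≟ y
  ... | yes w≡y = w≡y
  ... | no w≢y with collision-missed (trans (sym gx≡gw) gx≡gy) w≢y
  ...   | inj₁ w-missed = contradiction (missed-unique s-injective x-missed w-missed) x≢w
  ...   | inj₂ y-missed = contradiction (missed-unique s-injective x-missed y-missed) x≢y

  collision-through-missed : ∀ {x y u v} → Missed x → g x ≡ g y → x ≢ y →
                             g u ≡ g v → u ≢ v → (u , v) ≐ (x , y)
  collision-through-missed x-missed gx≡gy x≢y gu≡gv u≢v with collision-missed gu≡gv u≢v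
  ... | inj₁ u-missed with refl ← missed-unique s-injective u-missed x-missed =
    inj₁ (refl , collision-partner x-missed gx≡gy x≢y gu≡gv u≢v)
  ... | inj₂ v-missed with refl ← missed-unique s-injective v-missed x-missed =
    inj₂ (collision-partner x-missed gx≡gy x≢y (sym gu≡gv) (u≢v ∘ sym) , refl)

  collision-unique : ∀ {x y u v} → g x ≡ g y → x ≢ y → g u ≡ g v → u ≢ v → (u , v) ≐ (x , y)
  collision-unique gx≡gy x≢y gu≡gv u≢v with collision-missed gx≡gy x≢y
  ... | inj₁ x-missed = collision-through-missed x-missed gx≡gy x≢y gu≡gv u≢v
  ... | inj₂ y-missed = swap (collision-through-missed y-missed (sym gx≡gy) (x≢y ∘ sym) gu≡gv u≢v)

module _ {A : Set} where
  open import Function.Endo.Propositional A using (_^_; ^-homo)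

  ^-commute : ∀ (f : A → A) a x → (f ^ a) (f x) ≡ f ((f ^ a) x)
  ^-commute f a x = trans (sym (cong-app (^-homo f a 1) x)) (cong (λ b → (f ^ b) x) (+-comm a 1))

  ^-inverse : ∀ {f g : A → A} → (∀ x → f (g x) ≡ x) → ∀ a x → (f ^ a) ((g ^ a) x) ≡ x
  ^-inverse f∘g≡id zero x = refl
  ^-inverse {f} {g} f∘g≡id (suc a) x = begin
    f ((f ^ a) (g ((g ^ a) x)))  ≡⟨ ^-commute f a _ ⟨
    (f ^ a) (f (g ((g ^ a) x)))  ≡⟨ cong (f ^ a) (f∘g≡id _) ⟩
    (f ^ a) ((g ^ a) x)          ≡⟨ ^-inverse f∘g≡id a x ⟩
    x                            ∎
    where open ≡-Reasoning

  bijective-by-inverse : (f g : A → A) → (∀ x → f (g x) ≡ x) → (∀ x → g (f x) ≡ x) →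
                         Bijective _≡_ _≡_ f
  bijective-by-inverse f g f∘g≡id g∘f≡id = Bijection.bijective (↔⇒⤖ (mk↔ₛ′ f g f∘g≡id g∘f≡id))

module Cycle (n : ℕ) where
  open import Function.Endo.Propositional (Fin (suc n)) using (_^_)

  k : ℕ
  k = suc n

  toℕ-next : ∀ i → toℕ (next i) ≡ suc (toℕ i) % k
  toℕ-next i = toℕ-fromℕ< (m%n<n (suc (toℕ i)) k)

  toℕ-next-cases : ∀ i → toℕ (next i) ≡ suc (toℕ i) ⊎ (toℕ (next i) ≡ 0 × suc (toℕ i) ≡ k)
  toℕ-next-cases i with m≤n⇒m<n∨m≡n (toℕ<n i)
  ... | inj₁ i+1<k = inj₁ (trans (toℕ-next i) (m<n⇒m%n≡m i+1<k))
  ... | inj₂ i+1≡k = inj₂ (trans (toℕ-next i) (trans (cong (_% k) i+1≡k) (n%n≡0 k)) , i+1≡k)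

  toℕ-next^-zero : ∀ {a} → a < k → toℕ ((next ^ a) zero) ≡ a
  toℕ-next^-zero {zero} _ = refl
  toℕ-next^-zero {suc a} a+1<k = begin
    toℕ (next ((next ^ a) zero))     ≡⟨ toℕ-next _ ⟩
    suc (toℕ ((next ^ a) zero)) % k  ≡⟨ cong (λ b → suc b % k) (toℕ-next^-zero (<-trans (n<1+n a) a+1<k)) ⟩
    suc a % k                        ≡⟨ m<n⇒m%n≡m a+1<k ⟩
    suc a                            ∎
    where open ≡-Reasoning

  next^-toℕ : ∀ i → (next ^ toℕ i) zero ≡ i
  next^-toℕ i = toℕ-injective (toℕ-next^-zero (toℕ<n i))

  cyclic-induction : (Q : Fin k → Set) → Q zero → (∀ i → Q i → Q (next i)) → ∀ i → Q i
  cyclic-induction Q q₀ step i = subst Q (next^-toℕ i) (reach (toℕ i))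
    where
    reach : ∀ a → Q ((next ^ a) zero)
    reach zero = q₀
    reach (suc a) = step _ (reach a)

  next^k : ∀ i → (next ^ k) i ≡ i
  next^k = cyclic-induction (λ i → (next ^ k) i ≡ i) wraps
    (λ i e → trans (^-commute next k i) (cong next e))
    where
    wraps : (next ^ k) zero ≡ zero
    wraps = toℕ-injective (begin
      toℕ (next ((next ^ n) zero))      ≡⟨ toℕ-next _ ⟩
      suc (toℕ ((next ^ n) zero)) % k   ≡⟨ cong (λ b → suc b % k) (toℕ-next^-zero (n<1+n n)) ⟩
      k % k                             ≡⟨ n%n≡0 k ⟩
      0                                 ∎)
      where open ≡-Reasoning

  prev : Fin k → Fin k
  prev = next ^ n

  next-prev : ∀ i → next (prev i) ≡ i
  next-prev = next^k

  prev-next : ∀ i → prev (next i) ≡ i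
  prev-next i = trans (^-commute next n i) (next^k i)

  next-injective : Injective _≡_ _≡_ next
  next-injective {i} {j} e = trans (sym (prev-next i)) (trans (cong prev e) (prev-next j))

  prev^k : ∀ i → (prev ^ k) i ≡ i
  prev^k i = trans (cong (prev ^ k) (sym (next^k i))) (^-inverse {f = prev} {g = next} prev-next k i)

  next^-irrefl : ∀ {a} → 0 < a → a < k → ∀ i → (next ^ a) i ≢ i
  next^-irrefl {a} 0<a a<k = cyclic-induction (λ i → (next ^ a) i ≢ i)
    (λ e → <-irrefl (trans (sym (cong toℕ e)) (toℕ-next^-zero a<k)) 0<a)
    (λ i ne e → ne (next-injective (trans (sym (^-commute next a i)) e)))

  Intertwines : (Fin k → Fin k) → (Fin k → Fin k) → Set
  Intertwines F τ = ∀ i → τ (next i) ≡ F (τ i)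

  intertwines-unique : ∀ F {τ σ} → Intertwines F τ → Intertwines F σ →
                       τ zero ≡ σ zero → ∀ i → τ i ≡ σ i
  intertwines-unique F {τ} {σ} τ-F σ-F e₀ = cyclic-induction (λ i → τ i ≡ σ i) e₀
    (λ i e → trans (τ-F i) (trans (cong F e) (sym (σ-F i))))

  orbit : (Fin k → Fin k) → Fin k → Fin k → Fin k
  orbit F c i = (F ^ toℕ i) c

  orbit-intertwines : ∀ {F} c → (∀ x → (F ^ k) x ≡ x) → Intertwines F (orbit F c)
  orbit-intertwines {F} c F^k≡id i with toℕ-next-cases i
  ... | inj₁ e = cong (λ a → (F ^ a) c) e
  ... | inj₂ (e , i+1≡k) = begin
    (F ^ toℕ (next i)) c  ≡⟨ cong (λ a → (F ^ a) c) e ⟩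
    c                     ≡⟨ F^k≡id c ⟨
    (F ^ k) c             ≡⟨ cong (λ a → (F ^ a) c) i+1≡k ⟨
    (F ^ suc (toℕ i)) c   ∎
    where open ≡-Reasoning

  rotation reflection : Fin k → Fin k → Fin k
  rotation = orbit next
  reflection = orbit prev

  rotation-intertwines : ∀ c → Intertwines next (rotation c)
  rotation-intertwines c = orbit-intertwines c next^k

  reflection-intertwines : ∀ c → Intertwines prev (reflection c)
  reflection-intertwines c = orbit-intertwines c prev^k

  rotation≗next^ : ∀ c i → rotation c i ≡ (next ^ toℕ c) i
  rotation≗next^ c = intertwines-unique next (rotation-intertwines c)
    (λ i → ^-commute next (toℕ c) i) (sym (next^-toℕ c))

  rotation-bijective : ∀ c → Bijective _≡_ _≡_ (rotation c)
  rotation-bijective c = bijective-by-inverse (rotation c) (prev ^ toℕ c)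
    (λ y → trans (rotation≗next^ c _) (^-inverse next-prev (toℕ c) y))
    (λ x → trans (cong (prev ^ toℕ c) (rotation≗next^ c x)) (^-inverse {f = prev} {g = next} prev-next (toℕ c) x))

  reflection-involutive : ∀ c i → reflection c (reflection c i) ≡ i
  reflection-involutive c = intertwines-unique next ρ²-next (λ _ → refl) ρ²-zero
    where
    ρ : Fin k → Fin k
    ρ = reflection c
    ρ-prev : ∀ x → ρ (prev x) ≡ next (ρ x)
    ρ-prev x = begin
      ρ (prev x)               ≡⟨ next-prev _ ⟨
      next (prev (ρ (prev x))) ≡⟨ cong next (reflection-intertwines c (prev x)) ⟨
      next (ρ (next (prev x))) ≡⟨ cong (next ∘ ρ) (next-prev x) ⟩
      next (ρ x)               ∎
      where open ≡-Reasoning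
    ρ²-next : Intertwines next (ρ ∘ ρ)
    ρ²-next i = trans (cong ρ (reflection-intertwines c i)) (ρ-prev (ρ i))
    ρ²-zero : ρ (ρ zero) ≡ zero
    ρ²-zero = trans (cong (prev ^ toℕ c) (sym (next^-toℕ c)))
                    (^-inverse {f = prev} {g = next} prev-next (toℕ c) zero)

  reflection-bijective : ∀ c → Bijective _≡_ _≡_ (reflection c)
  reflection-bijective c =
    bijective-by-inverse (reflection c) (reflection c) (reflection-involutive c) (reflection-involutive c)

  next-irrefl : 1 < k → ∀ i → next i ≢ i
  next-irrefl = next^-irrefl {1} z<s

  next²-irrefl : 2 < k → ∀ i → next (next i) ≢ i
  next²-irrefl = next^-irrefl {2} z<s

  next³-irrefl : 3 < k → ∀ i → next (next (next i)) ≢ i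
  next³-irrefl = next^-irrefl {3} z<s

  distinct-neighbours : ∀ {τ : Fin k → Fin k} → 1 < k → Injective _≡_ _≡_ τ →
                        ∀ i → τ i ≢ τ (next i)
  distinct-neighbours 1<k τ-inj i e = next-irrefl 1<k i (sym (τ-inj e))

  Adjacent : Fin k → Fin k → Set
  Adjacent a b = b ≡ next a ⊎ a ≡ next b

  Endpoint : Fin k → Fin k → Set
  Endpoint x j = x ≡ j ⊎ x ≡ next j

  endpoints-adjacent : ∀ {a b j} → Endpoint a j → Endpoint b j → a ≢ b → Adjacent a b
  endpoints-adjacent (inj₁ refl) (inj₁ refl) a≢b = ⊥-elim (a≢b refl)
  endpoints-adjacent (inj₁ refl) (inj₂ refl) _ = inj₁ refl
  endpoints-adjacent (inj₂ refl) (inj₁ refl) _ = inj₂ refl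
  endpoints-adjacent (inj₂ refl) (inj₂ refl) a≢b = ⊥-elim (a≢b refl)

  direction : Fin 2 → Fin k → Fin k
  direction zero = next
  direction (suc zero) = prev

  orientation : ∀ {τ : Fin k → Fin k} → 2 < k → Injective _≡_ _≡_ τ →
                (∀ i → Adjacent (τ i) (τ (next i))) →
                Σ (Fin 2) λ o → Intertwines (direction o) τ
  orientation {τ} 2<k τ-inj adjacent with adjacent zero
  ... | inj₁ forward₀ = zero , cyclic-induction (λ i → τ (next i) ≡ next (τ i)) forward₀ forward
    where
    forward : ∀ i → τ (next i) ≡ next (τ i) → τ (next (next i)) ≡ next (τ (next i))
    forward i e with adjacent (next i)
    ... | inj₁ e′ = e′
    ... | inj₂ e′ = ⊥-elim (next²-irrefl 2<k i (sym (τ-inj (next-injective (trans (sym e) e′)))))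
  ... | inj₂ backward₀ = suc zero , λ i → trans (sym (prev-next _)) (cong prev (sym (backwards i)))
    where
    backward : ∀ i → τ i ≡ next (τ (next i)) → τ (next i) ≡ next (τ (next (next i)))
    backward i e with adjacent (next i)
    ... | inj₁ e′ = ⊥-elim (next²-irrefl 2<k i (τ-inj (trans e′ (sym e))))
    ... | inj₂ e′ = e′
    backwards : ∀ i → τ i ≡ next (τ (next i))
    backwards = cyclic-induction (λ i → τ i ≡ next (τ (next i))) backward₀ backward

  -- (zero , c) is i ↦ c + i and (suc zero , c) is i ↦ c − i in ℤ/k.
  dihedral : Fin 2 × Fin k → Fin k → Fin k
  dihedral (o , c) = orbit (direction o) c

  dihedral-intertwines : ∀ o c → Intertwines (direction o) (dihedral (o , c))
  dihedral-intertwines zero = rotation-intertwines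
  dihedral-intertwines (suc zero) = reflection-intertwines

  dihedral-bijective : ∀ d → Bijective _≡_ _≡_ (dihedral d)
  dihedral-bijective (zero , c) = rotation-bijective c
  dihedral-bijective (suc zero , c) = reflection-bijective c

  dihedral-complete : ∀ o {τ} → Intertwines (direction o) τ → ∀ i → dihedral (o , τ zero) i ≡ τ i
  dihedral-complete o {τ} τ-o = intertwines-unique (direction o) (dihedral-intertwines o (τ zero)) τ-o refl

  directions-distinct : 2 < k → ∀ o o′ x → direction o x ≡ direction o′ x → o ≡ o′
  directions-distinct _ zero zero _ _ = refl
  directions-distinct _ (suc zero) (suc zero) _ _ = refl
  directions-distinct 2<k zero (suc zero) x e = ⊥-elim (next²-irrefl 2<k x (trans (cong next e) (next-prev x)))
  directions-distinct 2<k (suc zero) zero x e = ⊥-elim (next²-irrefl 2<k x (trans (cong next (sym e)) (next-prev x)))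

  dihedral-injective : 2 < k → ∀ d d′ → (∀ i → dihedral d i ≡ dihedral d′ i) → d ≡ d′
  dihedral-injective 2<k (o , c) (o′ , c′) d≗d′ =
    cong₂ _,_ (directions-distinct 2<k o o′ c first-steps) (d≗d′ zero)
    where
    first-steps : direction o c ≡ direction o′ c
    first-steps = begin
      direction o c                    ≡⟨ dihedral-intertwines o c zero ⟨
      dihedral (o , c) (next zero)     ≡⟨ d≗d′ (next zero) ⟩
      dihedral (o′ , c′) (next zero)   ≡⟨ dihedral-intertwines o′ c′ zero ⟩
      direction o′ c′                  ≡⟨ cong (direction o′) (d≗d′ zero) ⟨
      direction o′ c                   ∎
      where open ≡-Reasoning

  dihedral-sides : ∀ d → Σ (Fin k → Fin k) λ σ → StrictlySurjective _≡_ σ ×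
                   (∀ i → (dihedral d i , dihedral d (next i)) ≐ (σ i , next (σ i)))
  dihedral-sides (zero , c) = rotation c , surjective⇒strictlySurjective (proj₂ (rotation-bijective c)) ,
    λ i → inj₁ (refl , rotation-intertwines c i)
  dihedral-sides (suc zero , c) = ρ ∘ next ,
    (λ y → prev (ρ y) , trans (cong ρ (next-prev _)) (reflection-involutive c y)) ,
    λ i → inj₂ (trans (sym (next-prev _)) (cong next (sym (reflection-intertwines c i))) , refl)
    where
    ρ : Fin k → Fin k
    ρ = reflection c

  no-side-between : 3 < k → ∀ {s i} →
                    i ≡ s ⊎ i ≡ next (next s) → next i ≡ s ⊎ next i ≡ next (next s) → ⊥
  no-side-between 3<k {s} = cases
    where
    1<k : 1 < k
    1<k = <⇒≤ (<⇒≤ 3<k)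
    cases : ∀ {i} → i ≡ s ⊎ i ≡ next (next s) → next i ≡ s ⊎ next i ≡ next (next s) → ⊥
    cases (inj₁ refl) (inj₁ e) = next-irrefl 1<k s e
    cases (inj₁ refl) (inj₂ e) = next-irrefl 1<k s (sym (next-injective e))
    cases (inj₂ refl) (inj₁ e) = next³-irrefl 3<k s e
    cases (inj₂ refl) (inj₂ e) = next-irrefl 1<k _ e

  -- L is the line carrying the sides m and next m, through the vertices m, next m, next (next m).
  module DoubledSide (m : Fin k) where

    SideOnL : Fin k → Set
    SideOnL j = j ≡ m ⊎ j ≡ next m

    VertexOnL : Fin k → Set
    VertexOnL x = x ≡ m ⊎ x ≡ next m ⊎ x ≡ next (next m)

    OuterOnL : Fin k → Set
    OuterOnL x = x ≡ m ⊎ x ≡ next (next m)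

    SameLine : Fin k → Fin k → Set
    SameLine j j′ = j ≡ j′ ⊎ (SideOnL j × SideOnL j′)

    Joined : Fin k → Fin k → Set
    Joined a b = ∃₂ λ j j′ → SameLine j j′ × Endpoint a j × Endpoint b j′

    endpoint-onL : ∀ {x j} → Endpoint x j → SideOnL j → VertexOnL x
    endpoint-onL (inj₁ refl) (inj₁ refl) = inj₁ refl
    endpoint-onL (inj₁ refl) (inj₂ refl) = inj₂ (inj₁ refl)
    endpoint-onL (inj₂ refl) (inj₁ refl) = inj₂ (inj₁ refl)
    endpoint-onL (inj₂ refl) (inj₂ refl) = inj₂ (inj₂ refl)

    middle-sideOnL : ∀ {j} → Endpoint (next m) j → SideOnL j
    middle-sideOnL (inj₁ e) = inj₂ (sym e)
    middle-sideOnL (inj₂ e) = inj₁ (sym (next-injective e))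

    sameLine-onLʳ : ∀ {j j′} → SameLine j j′ → SideOnL j → SideOnL j′
    sameLine-onLʳ (inj₁ refl) onL = onL
    sameLine-onLʳ (inj₂ (_ , onL′)) _ = onL′

    sameLine-onLˡ : ∀ {j j′} → SameLine j j′ → SideOnL j′ → SideOnL j
    sameLine-onLˡ (inj₁ refl) onL = onL
    sameLine-onLˡ (inj₂ (onL , _)) _ = onL

    joined-middleˡ : ∀ {b} → Joined (next m) b → VertexOnL b
    joined-middleˡ (_ , _ , same , em , eb) = endpoint-onL eb (sameLine-onLʳ same (middle-sideOnL em))

    joined-middleʳ : ∀ {a} → Joined a (next m) → VertexOnL a
    joined-middleʳ (_ , _ , same , ea , em) = endpoint-onL ea (sameLine-onLˡ same (middle-sideOnL em))

    onL-cases : ∀ {a b} → VertexOnL a → VertexOnL b → a ≢ b → Adjacent a b ⊎ (OuterOnL a × OuterOnL b)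
    onL-cases (inj₁ refl)        (inj₁ refl)        a≢b = ⊥-elim (a≢b refl)
    onL-cases (inj₁ refl)        (inj₂ (inj₁ refl)) _   = inj₁ (inj₁ refl)
    onL-cases (inj₁ refl)        (inj₂ (inj₂ refl)) _   = inj₂ (inj₁ refl , inj₂ refl)
    onL-cases (inj₂ (inj₁ refl)) (inj₁ refl)        _   = inj₁ (inj₂ refl)
    onL-cases (inj₂ (inj₁ refl)) (inj₂ (inj₁ refl)) a≢b = ⊥-elim (a≢b refl)
    onL-cases (inj₂ (inj₁ refl)) (inj₂ (inj₂ refl)) _   = inj₁ (inj₁ refl)
    onL-cases (inj₂ (inj₂ refl)) (inj₁ refl)        _   = inj₂ (inj₂ refl , inj₁ refl)
    onL-cases (inj₂ (inj₂ refl)) (inj₂ (inj₁ refl)) _   = inj₁ (inj₂ refl)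
    onL-cases (inj₂ (inj₂ refl)) (inj₂ (inj₂ refl)) a≢b = ⊥-elim (a≢b refl)

    joined-cases : ∀ {a b} → Joined a b → a ≢ b → Adjacent a b ⊎ (OuterOnL a × OuterOnL b)
    joined-cases (_ , _ , inj₁ refl , ea , eb) a≢b = inj₁ (endpoints-adjacent ea eb a≢b)
    joined-cases (_ , _ , inj₂ (onL , onL′) , ea , eb) a≢b =
      onL-cases (endpoint-onL ea onL) (endpoint-onL eb onL′) a≢b

    onL-outer : ∀ {x} → VertexOnL x → x ≢ next m → OuterOnL x
    onL-outer (inj₁ e) _ = inj₁ e
    onL-outer (inj₂ (inj₁ e)) x≢m₁ = ⊥-elim (x≢m₁ e)
    onL-outer (inj₂ (inj₂ e)) _ = inj₂ e

    outer-pair : ∀ {x y z} → OuterOnL x → OuterOnL y → x ≢ y → OuterOnL z → z ≡ x ⊎ z ≡ y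
    outer-pair (inj₁ refl) (inj₁ refl) x≢y _ = ⊥-elim (x≢y refl)
    outer-pair (inj₂ refl) (inj₂ refl) x≢y _ = ⊥-elim (x≢y refl)
    outer-pair (inj₁ refl) (inj₂ refl) _ (inj₁ refl) = inj₁ refl
    outer-pair (inj₁ refl) (inj₂ refl) _ (inj₂ refl) = inj₂ refl
    outer-pair (inj₂ refl) (inj₁ refl) _ (inj₁ refl) = inj₂ refl
    outer-pair (inj₂ refl) (inj₁ refl) _ (inj₂ refl) = inj₁ refl

    no-outer-side : ∀ {τ : Fin k → Fin k} {s} → 3 < k → Injective _≡_ _≡_ τ → τ (next s) ≡ next m →
                    (∀ i → Joined (τ i) (τ (next i))) →
                    ∀ i → OuterOnL (τ i) → OuterOnL (τ (next i)) → ⊥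
    no-outer-side {τ} {s} 3<k τ-inj τs₁≡m₁ joined i outer outer′ =
      no-side-between 3<k (locate outer) (locate outer′)
      where
      τ-distinct : ∀ i → τ i ≢ τ (next i)
      τ-distinct = distinct-neighbours (<⇒≤ (<⇒≤ 3<k)) τ-inj
      outer-before : OuterOnL (τ s)
      outer-before = onL-outer (joined-middleʳ (subst (Joined (τ s)) τs₁≡m₁ (joined s)))
                               (λ e → τ-distinct s (trans e (sym τs₁≡m₁)))
      outer-after : OuterOnL (τ (next (next s)))
      outer-after =
        onL-outer (joined-middleˡ (subst (λ x → Joined x (τ (next (next s)))) τs₁≡m₁ (joined (next s))))
                  (λ e → τ-distinct (next s) (trans τs₁≡m₁ (sym e)))
      locate : ∀ {x} → OuterOnL (τ x) → x ≡ s ⊎ x ≡ next (next s)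
      locate outer
        with outer-pair outer-before outer-after (λ e → next²-irrefl (<⇒≤ 3<k) s (sym (τ-inj e))) outer
      ... | inj₁ e = inj₁ (τ-inj e)
      ... | inj₂ e = inj₂ (τ-inj e)

    adjacent-if-joined : ∀ {τ : Fin k → Fin k} {s} → 3 < k → Injective _≡_ _≡_ τ →
                         τ (next s) ≡ next m →
                         (∀ i → Joined (τ i) (τ (next i))) → ∀ i → Adjacent (τ i) (τ (next i))
    adjacent-if-joined 3<k τ-inj τs₁≡m₁ joined i
      with joined-cases (joined i) (distinct-neighbours (<⇒≤ (<⇒≤ 3<k)) τ-inj i)
    ... | inj₁ adjacent = adjacent
    ... | inj₂ (outer , outer′) = ⊥-elim (no-outer-side 3<k τ-inj τs₁≡m₁ joined i outer outer′)

SCard-from-↔ : ∀ Π {k c} (P : QuasiGon Π k) {A : Set} → Fin c ↔ A → (g : A → Fin k → Fin k) →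
               (∀ a → InS Π P (g a)) → (∀ a a′ → g a ≗ₚ g a′ → a ≡ a′) →
               (∀ τ → InS Π P τ → ∃ λ a → g a ≗ₚ τ) → SCard Π P c
SCard-from-↔ Π P e g g∈S g-injective g-complete =
  g ∘ to , g∈S ∘ to ,
  (λ j j′ g≗g′ → trans (sym (strictlyInverseʳ j))
                       (trans (cong from (g-injective _ _ g≗g′)) (strictlyInverseʳ j′))) ,
  λ τ τ∈S → let (a , ga≗τ) = g-complete τ τ∈S in
    from a , λ i → trans (cong (λ b → g b i) (strictlyInverseˡ a)) (ga≗τ i)
  where open Inverse e

module Polygon (Π : ProjectivePlane) {n : ℕ} (P : QuasiGon Π (suc n)) (P-inj : IsQuasiGon Π P) where
  open ProjectivePlane Π
  open Cycle n

  incident-≐ : ∀ {A B C D M} → (A , B) ≐ (C , D) → (A I M × B I M) → (C I M × D I M)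
  incident-≐ (inj₁ (refl , refl)) onM = onM
  incident-≐ (inj₂ (refl , refl)) (A-onM , B-onM) = B-onM , A-onM

  endpoint-≐ : ∀ {A B C D Q : Point} → (A , B) ≐ (C , D) → Q ≡ A ⊎ Q ≡ B → Q ≡ C ⊎ Q ≡ D
  endpoint-≐ (inj₁ (refl , refl)) q = q
  endpoint-≐ (inj₂ (refl , refl)) q = swap q

  sameGraph-by-sides : ∀ {τ} σ → StrictlySurjective _≡_ τ → StrictlySurjective _≡_ σ →
                       (∀ i → (τ i , τ (next i)) ≐ (σ i , next (σ i))) → SameGraph Π (P ∘ τ) P
  sameGraph-by-sides {τ} σ τ-surj σ-surj sides =
    (λ Q → mk⇔ (λ (i , e) → τ i , e) vertex-back) ,
    (λ M → mk⇔ (λ (i , h) → σ i , incident-≐ (ends i) h) line-back) ,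
    (λ Q M → mk⇔ (λ (i , h , q) → σ i , incident-≐ (ends i) h , endpoint-≐ (ends i) q) edge-back)
    where
    ends : ∀ i → (P (τ i) , P (τ (next i))) ≐ (P (σ i) , P (next (σ i)))
    ends i = ≐-map P (sides i)
    vertex-back : ∀ {Q} → VertP Π P Q → VertP Π (P ∘ τ) Q
    vertex-back (j , e) with τ-surj j
    ... | i , refl = i , e
    line-back : ∀ {M} → InL Π P M → InL Π (P ∘ τ) M
    line-back (j , h) with σ-surj j
    ... | i , refl = i , incident-≐ (≐-sym (ends i)) h
    edge-back : ∀ {Q M} → Edge Π P Q M → Edge Π (P ∘ τ) Q M
    edge-back (j , h , q) with σ-surj j
    ... | i , refl = i , incident-≐ (≐-sym (ends i)) h , endpoint-≐ (≐-sym (ends i)) q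

  dihedral-InS : ∀ d → InS Π P (dihedral d)
  dihedral-InS d =
    let (σ , σ-surj , sides) = dihedral-sides d in
    dihedral-bijective d ,
    sameGraph-by-sides σ (surjective⇒strictlySurjective (proj₂ (dihedral-bijective d))) σ-surj sides

  endpoint-of-edge : ∀ {x M} → Edge Π P (P x) M → ∃ λ j → IsSide Π P j M × Endpoint x j
  endpoint-of-edge (j , h , inj₁ e) = j , h , inj₁ (P-inj e)
  endpoint-of-edge (j , h , inj₂ e) = j , h , inj₂ (P-inj e)

  module WithDoubledSide (1<k : 1 < k) (lines : LinesCard Π P n)
                         (m : Fin k) (L : Line) (m-on-L : IsSide Π P m L) (m₁-on-L : IsSide Π P (next m) L) where
    open DoubledSide m

    P-distinct : ∀ j → P j ≢ P (next j)
    P-distinct j e = next-irrefl 1<k j (sym (P-inj e))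

    sideLine : Fin k → Line
    sideLine j = proj₁ (line-exists (P j) (P (next j)) (P-distinct j))

    sideLine-incident : ∀ j → IsSide Π P j (sideLine j)
    sideLine-incident j = proj₂ (line-exists (P j) (P (next j)) (P-distinct j))

    sideLine-unique : ∀ {j M} → IsSide Π P j M → M ≡ sideLine j
    sideLine-unique {j} (Pj-onM , Pj₁-onM) =
      line-unique (P-distinct j) Pj-onM Pj₁-onM (proj₁ (sideLine-incident j)) (proj₂ (sideLine-incident j))

    sides-on-one-line : ∀ {j j′ M} → IsSide Π P j M → IsSide Π P j′ M → SameLine j j′
    sides-on-one-line {j} {j′} hj hj′ with j ≟ j′
    ... | yes j≡j′ = inj₁ j≡j′
    ... | no j≢j′ = inj₂ (on-L (collision-unique chosen-sides-injective
            (trans (sym (sideLine-unique m-on-L)) (sideLine-unique m₁-on-L)) (λ e → next-irrefl 1<k m (sym e))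
            (trans (sym (sideLine-unique hj)) (sideLine-unique hj′)) j≢j′))
      where
      -- The k − 1 lines choose k − 1 sides on distinct lines, so sideLine identifies at most one pair.
      f : Fin n → Line
      f = proj₁ lines
      chosen-side : ∀ a → ∃ λ i → IsSide Π P i (f a)
      chosen-side = proj₁ (proj₂ (proj₂ lines))
      chosen-sides-injective : Injective _≡_ _≡_ (sideLine ∘ proj₁ ∘ chosen-side)
      chosen-sides-injective {a} {b} e = proj₁ (proj₂ lines)
        (trans (sideLine-unique (proj₂ (chosen-side a))) (trans e (sym (sideLine-unique (proj₂ (chosen-side b))))))
      on-L : (j , j′) ≐ (m , next m) → SideOnL j × SideOnL j′
      on-L (inj₁ (e , e′)) = inj₁ e , inj₂ e′
      on-L (inj₂ (e , e′)) = inj₂ e , inj₁ e′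

    joined-by-symmetry : ∀ {τ} → Injective _≡_ _≡_ τ →
                         (∀ Q M → Edge Π (P ∘ τ) Q M → Edge Π P Q M) →
                         ∀ i → Joined (τ i) (τ (next i))
    joined-by-symmetry {τ} τ-inj edges i =
      let (M , onM , onM′) = line-exists (P (τ i)) (P (τ (next i))) (distinct-neighbours 1<k τ-inj i ∘ P-inj)
          (j , hj , ej) = endpoint-of-edge (edges _ _ (i , (onM , onM′) , inj₁ refl))
          (j′ , hj′ , ej′) = endpoint-of-edge (edges _ _ (i , (onM , onM′) , inj₂ refl))
      in j , j′ , sides-on-one-line hj hj′ , ej , ej′

lemma3 : (Π : ProjectivePlane) (k : ℕ) → 4 ≤ k →
    (P : QuasiGon Π k) → IsQuasiGon Π P →
    LinesCard Π P (k ∸ 1) →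
    Σ (Fin k) (λ m → Σ (ProjectivePlane.Line Π) (λ L → IsSide Π P m L × IsSide Π P (next m) L)) →
    SCard Π P (2 * k)
lemma3 Π zero () _ _ _ _
lemma3 Π (suc n) 4≤k P P-inj lines (m , L , m-on-L , m₁-on-L) =
  SCard-from-↔ Π P *↔× dihedral dihedral-InS (dihedral-injective 2<k) dihedral-of-symmetry
  where
  open Cycle n
  open DoubledSide m
  open Polygon Π P P-inj
  2<k : 2 < k
  2<k = <⇒≤ 4≤k
  open WithDoubledSide (<⇒≤ 2<k) lines m L m-on-L m₁-on-L
  dihedral-of-symmetry : ∀ τ → InS Π P τ → ∃ λ d → dihedral d ≗ₚ τ
  dihedral-of-symmetry τ ((τ-inj , τ-surj) , _ , _ , same-edges) =
    let (t , τt≡m₁) = surjective⇒strictlySurjective τ-surj (next m)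
        joined = joined-by-symmetry τ-inj (λ Q M → Equivalence.to (same-edges Q M))
        (o , τ-o) = orientation 2<k τ-inj
                      (adjacent-if-joined 4≤k τ-inj (trans (cong τ (next-prev t)) τt≡m₁) joined)
    in (o , τ zero) , dihedral-complete o τ-o
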